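{- Let $G$ be a finite bipartite graph and $\{C,H\}$ a decomposition of $G$ such that $V(C)\cap V(H)=[n]=\{1,\dots,n\}$, all vertices of $[n]$ lie in the same bipartite class of $G$, every vertex of $[n]$ is 2-layered in $G$, and every vertex of $[n]$ has at least one neighbour in $C$ and at least one neighbour in $H$. Then for any $\Theta\subseteq[n]$, $\Gamma\subseteq\Theta^{\mathsf{c}}$ and $b\in V(C\setminus\Gamma)$, \[ w_{C\setminus\Gamma}\big(\Theta,\overline{\Theta^{\mathsf{c}}\cup N_{C}(\Gamma)}\big)=w_{C}\big(\Theta\cup\Gamma,\overline{\Theta^{\mathsf{c}}\setminus\Gamma}\big)\] and \[ w_{C\setminus\Gamma}\big(\{b\}\cup\Theta,\overline{\Theta^{\mathsf{c}}\cup N_{C}(\Gamma)}\big)=w_{C}\big(\{b\}\cup\Theta\cup\Gamma,\overline{\Theta^{\mathsf{c}}\setminus\Gamma}\big).\]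
   Context: A stable set of a graph is a set of pairwise non-adjacent vertices; it is maximal if no further vertex can be added while keeping it stable. A decomposition of $G$ is a set of pairwise edge-disjoint subgraphs whose union (of vertex sets and edge sets) is $G$. A pendant vertex is a vertex of degree $1$ in $G$; a vertex $v$ is 2-layered in $G$ if every neighbour of $v$ in $G$ is adjacent to a pendant vertex of $G$. For $\Theta\subseteq[n]$, $\Theta^{\mathsf{c}}=[n]\setminus\Theta$. For a subgraph $K$ of $G$ and a vertex set $\Gamma$, $K\setminus\Gamma$ is the graph obtained from $K$ by deleting the vertices of $\Gamma$; $N_K(P)$ is the set of vertices adjacent in $K$ to some vertex of $P$. For vertex sets $P,Q$, $\mathcal{B}_K(P,\overline{Q})$ is the family of maximal stable sets of $K$ that contain every vertex of $P$ and no vertex of $Q$, and $w_K(P,\overline{Q})=|\mathcal{B}_K(P,\overline{Q})|$. -}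

module Defs where

open import Data.Bool using (Bool; true; false; T; not; _∧_; _∨_)
open import Data.Nat using (ℕ; zero; suc)
open import Data.Fin using (Fin)
open import Data.Vec using (Vec; []; _∷_; lookup; tabulate)
open import Data.List using (List; map; _++_; length; filterᵇ; allFin)
open import Data.Bool.ListAction using (all; any)
open import Data.Fin.Subset using (Subset; outside; inside; _∪_; _─_; _∩_; ⁅_⁆; _∈_)
open import Data.Product using (Σ; ∃; _×_; _,_)
open import Relation.Nullary using (¬_)
open import Relation.Binary.PropositionalEquality using (_≡_; _≢_)

_∈ᵇ_ : {m : ℕ} → Fin m → Subset m → Bool
v ∈ᵇ S = lookup S v

allV : {m : ℕ} → (Fin m → Bool) → Bool
allV {m} p = all p (allFin m)

anyV : {m : ℕ} → (Fin m → Bool) → Bool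
anyV {m} p = any p (allFin m)

_⊆ᵇ_ : {m : ℕ} → Subset m → Subset m → Bool
P ⊆ᵇ Q = allV (λ v → not (v ∈ᵇ P) ∨ (v ∈ᵇ Q))

disjointᵇ : {m : ℕ} → Subset m → Subset m → Bool
disjointᵇ P Q = allV (λ v → not ((v ∈ᵇ P) ∧ (v ∈ᵇ Q)))

subsets : (m : ℕ) → List (Subset m)
subsets zero    = [] Data.List.∷ Data.List.[]
subsets (suc m) = map (outside ∷_) (subsets m) ++ map (inside ∷_) (subsets m)

record Graph (m : ℕ) : Set where
  field
    adj    : Fin m → Fin m → Bool
    sym    : ∀ u v → adj u v ≡ adj v u
    irrefl : ∀ v → adj v v ≡ false
open Graph public

record SubGraph (m : ℕ) : Set where
  field
    vert : Subset m
    edge : Fin m → Fin m → Bool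
open SubGraph public

IsSubgraphOf : {m : ℕ} → SubGraph m → Graph m → Set
IsSubgraphOf K G =
  (∀ u v → edge K u v ≡ edge K v u) ×
  (∀ u v → T (edge K u v) → T (adj G u v)) ×
  (∀ u v → T (edge K u v) → u ∈ vert K × v ∈ vert K)

IsDecomposition : {m : ℕ} → Graph m → SubGraph m → SubGraph m → Set
IsDecomposition G C H =
  IsSubgraphOf C G × IsSubgraphOf H G ×
  (∀ u v → T (edge C u v) → T (edge H u v) → Data.Empty.⊥) ×
  (∀ v → T ((v ∈ᵇ vert C) ∨ (v ∈ᵇ vert H))) ×
  (∀ u v → adj G u v ≡ (edge C u v ∨ edge H u v))
  where import Data.Empty

IsBipartition : {m : ℕ} → Graph m → (Fin m → Bool) → Set
IsBipartition G col = ∀ u v → T (adj G u v) → col u ≢ col v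

countᵇ : {A : Set} → (A → Bool) → List A → ℕ
countᵇ p xs = length (filterᵇ p xs)

degree : {m : ℕ} → Graph m → Fin m → ℕ
degree G v = countᵇ (adj G v) (allFin _)

Pendant : {m : ℕ} → Graph m → Fin m → Set
Pendant G p = degree G p ≡ 1

TwoLayered : {m : ℕ} → Graph m → Fin m → Set
TwoLayered G v = ∀ u → T (adj G v u) → ∃ λ p → T (adj G u p) × Pendant G p

_∖_ : {m : ℕ} → SubGraph m → Subset m → SubGraph m
K ∖ Γ = record
  { vert = vert K ─ Γ
  ; edge = λ u v → edge K u v ∧ not (u ∈ᵇ Γ) ∧ not (v ∈ᵇ Γ) }

N : {m : ℕ} → SubGraph m → Subset m → Subset m
N K P = tabulate (λ v → anyV (λ u → (u ∈ᵇ P) ∧ edge K u v))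

isStable : {m : ℕ} → SubGraph m → Subset m → Bool
isStable K S =
  (S ⊆ᵇ vert K) ∧
  allV (λ u → allV (λ v → not ((u ∈ᵇ S) ∧ (v ∈ᵇ S) ∧ edge K u v)))

isMaxStable : {m : ℕ} → SubGraph m → Subset m → Bool
isMaxStable K S =
  isStable K S ∧
  allV (λ v → not ((v ∈ᵇ vert K) ∧ not (v ∈ᵇ S)) ∨ not (isStable K (S ∪ ⁅ v ⁆)))

-- w_K(P, Q̄) = |B_K(P, Q̄)|: number of maximal stable sets of K containing
-- every vertex of P and no vertex of Q
w : {m : ℕ} → SubGraph m → Subset m → Subset m → ℕ
w {m} K P Q = countᵇ (λ S → isMaxStable K S ∧ (P ⊆ᵇ S) ∧ disjointᵇ S Q) (subsets m)

-- S ↦ S ∪ Γ is a bijection from the maximal stable sets of C ∖ Γ avoiding N_C(Γ) onto the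
-- maximal stable sets of C containing Γ; Γ itself is stable because V(C) ∩ V(H) lies in one
-- colour class. The only subtle point is maximality of S in C ∖ Γ: a vertex v adjacent to
-- some γ ∈ Γ has, by 2-layeredness of γ, a pendant neighbour p, which is a leaf of C outside
-- Γ; maximality of S ∪ Γ forces p ∈ S, so v cannot be added to S. The count is transported
-- along S ↦ S ⊕ Γ (symmetric difference), a permutation of all subsets that agrees with
-- S ↦ S ∪ Γ on the sets disjoint from Γ.
module Submission where

open import Defs
open import Data.Bool using (Bool; true; false; T; not; _∧_; _∨_; _xor_)
open import Data.Bool.Properties using (T-∧; T-∨; T-≡; T?)
open import Data.Nat using (ℕ; suc; _+_)
open import Data.Nat.Properties using (+-comm)
open import Data.Fin using (Fin)
open import Data.Fin.Subset using (Subset; _∪_; _─_; _∩_; ⁅_⁆; _∈_; _∉_; _⊆_; inside; outside)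
open import Data.Fin.Subset.Properties
  using (x∈p∪q⁻; x∈p∪q⁺; x∈p∩q⁻; x∈p∩q⁺; x∈⁅x⁆; x∈⁅y⁆⇒x≡y; x∈p∧x∉q⇒x∈p─q; p─q⊆p; p⊆p∪q; q⊆p∪q; _∈?_)
open import Data.Vec using ([]; _∷_; here; there; zipWith)
open import Data.Vec.Properties using ([]=⇒lookup; lookup⇒[]=; lookup∘tabulate)
open import Data.List using (List; []; _∷_; map; _++_; length; filterᵇ; allFin)
open import Data.List.Properties using (length-++; filter-++; filter-≐)
open import Data.List.Membership.Propositional using () renaming (_∈_ to _∈ₗ_)
open import Data.List.Membership.Propositional.Properties using (∈-filter⁺; ∈-allFin)
open import Data.List.Relation.Unary.All.Properties using (all⁺; all⁻; tabulate⁺; tabulate⁻)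
import Data.List.Relation.Unary.Any.Properties as Any
open import Data.List.Relation.Unary.Any using (here)
open import Data.Product using (∃; _×_; _,_; proj₁; proj₂)
open import Data.Sum using (_⊎_; inj₁; inj₂; [_,_])
import Data.Sum as Sum
open import Data.Unit using (tt)
open import Data.Empty using (⊥)
open import Function using (_∘_; id; flip)
open import Function.Bundles using (_⇔_; mk⇔; Equivalence)
open import Relation.Nullary using (¬_; yes; no; contradiction)
open import Relation.Binary.PropositionalEquality using (_≡_; refl; cong; cong₂; trans; subst; subst₂; module ≡-Reasoning) renaming (sym to ≡-sym)

open Equivalence using (to; from)

private
  variable
    m : ℕ
    a b : Bool
    u v x : Fin m
    A B P Q S X Z Γ : Subset m
    K : SubGraph m

T-not : T (not a) ⇔ (¬ T a)
T-not {a = true}  = mk⇔ (λ ()) (λ ¬t → ¬t tt)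
T-not {a = false} = mk⇔ (λ _ ()) (λ _ → tt)

T-implies : T (not a ∨ b) ⇔ (T a → T b)
T-implies {a = true}  = mk⇔ (λ t _ → t) (λ f → f tt)
T-implies {a = false} = mk⇔ (λ _ ()) (λ _ → tt)

T-nand : T (not (a ∧ b)) ⇔ (T a → ¬ T b)
T-nand {a = true}  = mk⇔ (λ t _ → to T-not t) (λ f → from T-not (f tt))
T-nand {a = false} = mk⇔ (λ _ ()) (λ _ → tt)

∈ᵇ⇔∈ : T (v ∈ᵇ S) ⇔ v ∈ S
∈ᵇ⇔∈ {v = v} {S = S} = mk⇔ (lookup⇒[]= v S ∘ to T-≡) (from T-≡ ∘ []=⇒lookup)

allV⇔ : {p : Fin m → Bool} → T (allV p) ⇔ (∀ v → T (p v))
allV⇔ {m = m} {p = p} = mk⇔ (tabulate⁻ ∘ all⁺ p (allFin m)) (all⁻ p ∘ tabulate⁺)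

anyV⇔ : {p : Fin m → Bool} → T (anyV p) ⇔ ∃ (T ∘ p)
anyV⇔ {m = m} {p = p} =
  mk⇔ (Any.tabulate⁻ ∘ Any.any⁻ p (allFin m)) (λ (v , pv) → Any.any⁺ p (Any.tabulate⁺ v pv))

⊆ᵇ⇔⊆ : T (P ⊆ᵇ Q) ⇔ P ⊆ Q
⊆ᵇ⇔⊆ {P = P} {Q = Q} = mk⇔
  (λ h {v} v∈P → to ∈ᵇ⇔∈ (to T-implies (to allV⇔ h v) (from ∈ᵇ⇔∈ v∈P)))
  (λ P⊆Q → from allV⇔ (pointwise P⊆Q))
  where
  pointwise : P ⊆ Q → ∀ v → T (not (v ∈ᵇ P) ∨ (v ∈ᵇ Q))
  pointwise P⊆Q v = from T-implies λ v∈P → from ∈ᵇ⇔∈ (P⊆Q (to ∈ᵇ⇔∈ v∈P))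

Disjoint : Subset m → Subset m → Set
Disjoint P Q = ∀ {v} → v ∈ P → v ∉ Q

disjointᵇ⇔Disjoint : T (disjointᵇ P Q) ⇔ Disjoint P Q
disjointᵇ⇔Disjoint {P = P} {Q = Q} = mk⇔
  (λ h {v} v∈P v∈Q → to T-nand (to allV⇔ h v) (from ∈ᵇ⇔∈ v∈P) (from ∈ᵇ⇔∈ v∈Q))
  (λ P#Q → from allV⇔ (pointwise P#Q))
  where
  pointwise : Disjoint P Q → ∀ v → T (not ((v ∈ᵇ P) ∧ (v ∈ᵇ Q)))
  pointwise P#Q v = from T-nand λ v∈P v∈Q → P#Q (to ∈ᵇ⇔∈ v∈P) (to ∈ᵇ⇔∈ v∈Q)

x∈p∪q∧x∉q⇒x∈p : x ∈ P ∪ Q → x ∉ Q → x ∈ P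
x∈p∪q∧x∉q⇒x∈p {P = P} {Q = Q} x∈P∪Q x∉Q = [ id , flip contradiction x∉Q ] (x∈p∪q⁻ P Q x∈P∪Q)

∈N⇔ : (K : SubGraph m) (P : Subset m) → v ∈ N K P ⇔ ∃ λ u → u ∈ P × T (edge K u v)
∈N⇔ {v = v} K P = mk⇔
  (λ h → let u , t = to anyV⇔ (subst T (lookup∘tabulate _ v) (from ∈ᵇ⇔∈ h)) ; u∈P , e = to T-∧ t
         in u , to ∈ᵇ⇔∈ u∈P , e)
  (λ (u , u∈P , e) → to ∈ᵇ⇔∈ (subst T (≡-sym (lookup∘tabulate _ v))
    (from anyV⇔ (u , from T-∧ (from ∈ᵇ⇔∈ u∈P , e)))))

_⊕_ : Subset m → Subset m → Subset m
p ⊕ q = zipWith _xor_ p q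

⊕≡∪ : (p q : Subset m) → Disjoint p q → p ⊕ q ≡ p ∪ q
⊕≡∪ []            []            _   = refl
⊕≡∪ (inside  ∷ p) (inside  ∷ q) p#q = contradiction here (p#q here)
⊕≡∪ (inside  ∷ p) (outside ∷ q) p#q = cong (inside ∷_)  (⊕≡∪ p q λ x∈p → p#q (there x∈p) ∘ there)
⊕≡∪ (outside ∷ p) (inside  ∷ q) p#q = cong (inside ∷_)  (⊕≡∪ p q λ x∈p → p#q (there x∈p) ∘ there)
⊕≡∪ (outside ∷ p) (outside ∷ q) p#q = cong (outside ∷_) (⊕≡∪ p q λ x∈p → p#q (there x∈p) ∘ there)

x∈p∩q⇒x∉p⊕q : x ∈ P → x ∈ Q → x ∉ P ⊕ Q
x∈p∩q⇒x∉p⊕q here      here      ()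
x∈p∩q⇒x∉p⊕q (there a) (there b) (there c) = x∈p∩q⇒x∉p⊕q a b c

x∈p─q⇒x∉q : x ∈ P ─ Q → x ∉ Q
x∈p─q⇒x∉q {P = _ ∷ _} {Q = outside ∷ _} (there a) (there b) = x∈p─q⇒x∉q a b
x∈p─q⇒x∉q {P = _ ∷ _} {Q = inside  ∷ _} (there a) (there b) = x∈p─q⇒x∉q a b

Independent : SubGraph m → Subset m → Set
Independent K S = ∀ {u v} → u ∈ S → v ∈ S → ¬ T (edge K u v)

Stable : SubGraph m → Subset m → Set
Stable K S = S ⊆ vert K × Independent K S

MaximalStable : SubGraph m → Subset m → Set
MaximalStable K S = Stable K S × (∀ {v} → v ∈ vert K → v ∉ S → ¬ Stable K (S ∪ ⁅ v ⁆))

Counted : SubGraph m → Subset m → Subset m → Subset m → Set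
Counted K P Q S = MaximalStable K S × P ⊆ S × Disjoint S Q

isStable⇔Stable : T (isStable K S) ⇔ Stable K S
isStable⇔Stable {K = K} {S = S} = mk⇔ reflect reify
  where
  reflect : T (isStable K S) → Stable K S
  reflect h = to ⊆ᵇ⇔⊆ (proj₁ (to T-∧ h)) , λ {u} {v} u∈S v∈S e →
    to T-nand (to allV⇔ (to allV⇔ (proj₂ (to (T-∧ {S ⊆ᵇ vert K}) h)) u) v)
      (from ∈ᵇ⇔∈ u∈S) (from T-∧ (from ∈ᵇ⇔∈ v∈S , e))
  pointwise : Independent K S → ∀ u v → T (not ((u ∈ᵇ S) ∧ (v ∈ᵇ S) ∧ edge K u v))
  pointwise ind u v = from T-nand λ u∈S ve →
    let v∈S , e = to T-∧ ve in ind (to ∈ᵇ⇔∈ u∈S) (to ∈ᵇ⇔∈ v∈S) e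
  reify : Stable K S → T (isStable K S)
  reify (S⊆K , ind) =
    from T-∧ (from ⊆ᵇ⇔⊆ S⊆K , from allV⇔ λ u → from allV⇔ (pointwise ind u))

isMaxStable⇔MaximalStable : T (isMaxStable K S) ⇔ MaximalStable K S
isMaxStable⇔MaximalStable {K = K} {S = S} = mk⇔ reflect reify
  where
  reflect : T (isMaxStable K S) → MaximalStable K S
  reflect h = to isStable⇔Stable (proj₁ (to T-∧ h)) , λ {v} v∈K v∉S st →
    to T-not (to T-implies (to allV⇔ (proj₂ (to (T-∧ {isStable K S}) h)) v)
      (from T-∧ (from ∈ᵇ⇔∈ v∈K , from T-not (v∉S ∘ to ∈ᵇ⇔∈)))) (from isStable⇔Stable st)
  pointwise : MaximalStable K S →
    ∀ v → T (not ((v ∈ᵇ vert K) ∧ not (v ∈ᵇ S)) ∨ not (isStable K (S ∪ ⁅ v ⁆)))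
  pointwise (_ , max) v = from T-implies λ h → let v∈K , v∉S = to T-∧ h in
    from T-not (max (to ∈ᵇ⇔∈ v∈K) (to T-not v∉S ∘ from ∈ᵇ⇔∈) ∘ to isStable⇔Stable)
  reify : MaximalStable K S → T (isMaxStable K S)
  reify mS = from T-∧ (from isStable⇔Stable (proj₁ mS) , from allV⇔ (pointwise mS))

counted⇔Counted : T (isMaxStable K S ∧ (P ⊆ᵇ S) ∧ disjointᵇ S Q) ⇔ Counted K P Q S
counted⇔Counted {K = K} {S = S} {P = P} {Q = Q} = mk⇔ reflect reify
  where
  reflect : T (isMaxStable K S ∧ (P ⊆ᵇ S) ∧ disjointᵇ S Q) → Counted K P Q S
  reflect h = let mS , rest = to T-∧ h ; P⊆S , S#Q = to T-∧ rest in
    to isMaxStable⇔MaximalStable mS , to ⊆ᵇ⇔⊆ P⊆S , to disjointᵇ⇔Disjoint S#Q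
  reify : Counted K P Q S → T (isMaxStable K S ∧ (P ⊆ᵇ S) ∧ disjointᵇ S Q)
  reify (mS , P⊆S , S#Q) = from T-∧ (from isMaxStable⇔MaximalStable mS ,
    from T-∧ (from ⊆ᵇ⇔⊆ P⊆S , from disjointᵇ⇔Disjoint S#Q))

edge-∖⇔ : T (edge (K ∖ Γ) u v) ⇔ (T (edge K u v) × u ∉ Γ × v ∉ Γ)
edge-∖⇔ {K = K} {Γ = Γ} {u = u} {v = v} = mk⇔ reflect reify
  where
  reflect : T (edge (K ∖ Γ) u v) → T (edge K u v) × u ∉ Γ × v ∉ Γ
  reflect h = let e , rest = to T-∧ h ; u∉Γ , v∉Γ = to T-∧ rest in
    e , to T-not u∉Γ ∘ from ∈ᵇ⇔∈ , to T-not v∉Γ ∘ from ∈ᵇ⇔∈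
  reify : T (edge K u v) × u ∉ Γ × v ∉ Γ → T (edge (K ∖ Γ) u v)
  reify (e , u∉Γ , v∉Γ) =
    from T-∧ (e , from T-∧ (from T-not (u∉Γ ∘ to ∈ᵇ⇔∈) , from T-not (v∉Γ ∘ to ∈ᵇ⇔∈)))

stable-∖⇔ : (K : SubGraph m) (Γ : Subset m) → Stable (K ∖ Γ) A ⇔ (Stable K A × Disjoint A Γ)
stable-∖⇔ {A = A} K Γ = mk⇔ reflect reify
  where
  reflect : Stable (K ∖ Γ) A → Stable K A × Disjoint A Γ
  reflect (A⊆K∖Γ , ind) =
    (p─q⊆p (vert K) Γ ∘ A⊆K∖Γ ,
     λ u∈A v∈A e → ind u∈A v∈A (from (edge-∖⇔ {K = K}) (e , A#Γ u∈A , A#Γ v∈A))) ,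
    A#Γ
    where
    A#Γ : Disjoint A Γ
    A#Γ = x∈p─q⇒x∉q ∘ A⊆K∖Γ
  reify : Stable K A × Disjoint A Γ → Stable (K ∖ Γ) A
  reify ((A⊆K , ind) , A#Γ) =
    (λ x∈A → x∈p∧x∉q⇒x∈p─q (A⊆K x∈A) (A#Γ x∈A)) ,
    λ u∈A v∈A e → ind u∈A v∈A (proj₁ (to (edge-∖⇔ {K = K} {Γ = Γ}) e))

stable-⊆ : A ⊆ B → Stable K B → Stable K A
stable-⊆ A⊆B (B⊆K , indB) = B⊆K ∘ A⊆B , λ u∈A v∈A → indB (A⊆B u∈A) (A⊆B v∈A)

module Subgraph {m : ℕ} {G : Graph m} {C : SubGraph m} (C⊆G : IsSubgraphOf C G) where

  edge-sym : T (edge C u v) → T (edge C v u)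
  edge-sym {u = u} {v = v} = subst T (proj₁ C⊆G u v)

  edge⇒adj : T (edge C u v) → T (adj G u v)
  edge⇒adj {u = u} {v = v} = proj₁ (proj₂ C⊆G) u v

  edge-irrefl : ¬ T (edge C v v)
  edge-irrefl = subst T (irrefl G _) ∘ edge⇒adj

  edge⇒∈vert : T (edge C u v) → v ∈ vert C
  edge⇒∈vert {u = u} {v = v} = proj₂ ∘ proj₂ (proj₂ C⊆G) u v

  stable-⁅⁆ : v ∈ vert C → Stable C ⁅ v ⁆
  stable-⁅⁆ {v = v} v∈C =
    (λ x∈⁅v⁆ → subst (_∈ vert C) (≡-sym (x∈⁅y⁆⇒x≡y v x∈⁅v⁆)) v∈C) ,
    λ x∈⁅v⁆ y∈⁅v⁆ → subst₂ (λ x y → ¬ T (edge C x y))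
      (≡-sym (x∈⁅y⁆⇒x≡y v x∈⁅v⁆)) (≡-sym (x∈⁅y⁆⇒x≡y v y∈⁅v⁆)) edge-irrefl

  stable-∪ : Stable C A → Stable C B → (∀ {x y} → x ∈ A → y ∈ B → ¬ T (edge C x y)) →
             Stable C (A ∪ B)
  stable-∪ {A = A} {B = B} (A⊆C , indA) (B⊆C , indB) A–B =
    (λ x∈A∪B → [ A⊆C , B⊆C ] (x∈p∪q⁻ A B x∈A∪B)) ,
    λ x∈A∪B y∈A∪B → independent (x∈p∪q⁻ A B x∈A∪B) (x∈p∪q⁻ A B y∈A∪B)
    where
    independent : x ∈ A ⊎ x ∈ B → v ∈ A ⊎ v ∈ B → ¬ T (edge C x v)
    independent (inj₁ x∈A) (inj₁ v∈A) = indA x∈A v∈A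
    independent (inj₁ x∈A) (inj₂ v∈B) = A–B x∈A v∈B
    independent (inj₂ x∈B) (inj₁ v∈A) = A–B v∈A x∈B ∘ edge-sym
    independent (inj₂ x∈B) (inj₂ v∈B) = indB x∈B v∈B

  ∈-maximalStable : MaximalStable C S → v ∈ vert C → (∀ {x} → T (edge C v x) → x ∉ S) → v ∈ S
  ∈-maximalStable {S = S} {v = v} (stS , maxS) v∈C noNeighbour with v ∈? S
  ... | yes v∈S = v∈S
  ... | no  v∉S = contradiction
    (stable-∪ stS (stable-⁅⁆ v∈C) λ x∈S y∈⁅v⁆ e →
      noNeighbour (edge-sym (subst (T ∘ edge C _) (x∈⁅y⁆⇒x≡y v y∈⁅v⁆) e)) x∈S)
    (maxS v∈C v∉S)

-- Counting maximal stable sets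

countᵇ-cong : {A : Set} {p q : A → Bool} → (∀ x → T (p x) ⇔ T (q x)) →
              ∀ xs → countᵇ p xs ≡ countᵇ q xs
countᵇ-cong {p = p} {q} p⇔q xs =
  cong length (filter-≐ (T? ∘ p) (T? ∘ q) ((λ {x} → to (p⇔q x)) , (λ {x} → from (p⇔q x))) xs)

countᵇ-++ : {A : Set} (p : A → Bool) (xs ys : List A) →
            countᵇ p (xs ++ ys) ≡ countᵇ p xs + countᵇ p ys
countᵇ-++ p xs ys = trans (cong length (filter-++ (T? ∘ p) xs ys)) (length-++ (filterᵇ p xs))

countᵇ-map : {A B : Set} (p : B → Bool) (f : A → B) (xs : List A) →
             countᵇ p (map f xs) ≡ countᵇ (p ∘ f) xs
countᵇ-map p f []       = refl
countᵇ-map p f (x ∷ xs) with p (f x)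
... | true  = cong suc (countᵇ-map p f xs)
... | false = countᵇ-map p f xs

countᵇ≡1⇒≡ : {A : Set} (p : A → Bool) {xs : List A} {x y : A} → countᵇ p xs ≡ 1 →
             x ∈ₗ xs → y ∈ₗ xs → T (p x) → T (p y) → x ≡ y
countᵇ≡1⇒≡ p {xs} count≡1 x∈xs y∈xs px py
  with filterᵇ p xs | ∈-filter⁺ (T? ∘ p) x∈xs px | ∈-filter⁺ (T? ∘ p) y∈xs py
... | _ ∷ [] | here refl | here refl = refl

countᵇ-subsets-suc : (q : Subset (suc m) → Bool) →
  countᵇ q (subsets (suc m)) ≡ countᵇ (q ∘ (outside ∷_)) (subsets m) + countᵇ (q ∘ (inside ∷_)) (subsets m)
countᵇ-subsets-suc {m = m} q = begin
  countᵇ q (map (outside ∷_) (subsets m) ++ map (inside ∷_) (subsets m))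
    ≡⟨ countᵇ-++ q (map (outside ∷_) (subsets m)) (map (inside ∷_) (subsets m)) ⟩
  countᵇ q (map (outside ∷_) (subsets m)) + countᵇ q (map (inside ∷_) (subsets m))
    ≡⟨ cong₂ _+_ (countᵇ-map q (outside ∷_) (subsets m)) (countᵇ-map q (inside ∷_) (subsets m)) ⟩
  countᵇ (q ∘ (outside ∷_)) (subsets m) + countᵇ (q ∘ (inside ∷_)) (subsets m) ∎
  where open ≡-Reasoning

countᵇ-⊕ : (Γ : Subset m) (q : Subset m → Bool) →
           countᵇ (q ∘ (_⊕ Γ)) (subsets m) ≡ countᵇ q (subsets m)
countᵇ-⊕ [] q with q []
... | true  = refl
... | false = refl
countᵇ-⊕ (outside ∷ Γ) q = begin
  countᵇ (q ∘ (_⊕ (outside ∷ Γ))) (subsets _)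
    ≡⟨ countᵇ-subsets-suc (q ∘ (_⊕ (outside ∷ Γ))) ⟩
  countᵇ (q ∘ (outside ∷_) ∘ (_⊕ Γ)) (subsets _) + countᵇ (q ∘ (inside ∷_) ∘ (_⊕ Γ)) (subsets _)
    ≡⟨ cong₂ _+_ (countᵇ-⊕ Γ (q ∘ (outside ∷_))) (countᵇ-⊕ Γ (q ∘ (inside ∷_))) ⟩
  countᵇ (q ∘ (outside ∷_)) (subsets _) + countᵇ (q ∘ (inside ∷_)) (subsets _)
    ≡⟨ countᵇ-subsets-suc q ⟨
  countᵇ q (subsets _) ∎
  where open ≡-Reasoning
countᵇ-⊕ (inside ∷ Γ) q = begin
  countᵇ (q ∘ (_⊕ (inside ∷ Γ))) (subsets _)
    ≡⟨ countᵇ-subsets-suc (q ∘ (_⊕ (inside ∷ Γ))) ⟩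
  countᵇ (q ∘ (inside ∷_) ∘ (_⊕ Γ)) (subsets _) + countᵇ (q ∘ (outside ∷_) ∘ (_⊕ Γ)) (subsets _)
    ≡⟨ cong₂ _+_ (countᵇ-⊕ Γ (q ∘ (inside ∷_))) (countᵇ-⊕ Γ (q ∘ (outside ∷_))) ⟩
  countᵇ (q ∘ (inside ∷_)) (subsets _) + countᵇ (q ∘ (outside ∷_)) (subsets _)
    ≡⟨ +-comm (countᵇ (q ∘ (inside ∷_)) (subsets _)) _ ⟩
  countᵇ (q ∘ (outside ∷_)) (subsets _) + countᵇ (q ∘ (inside ∷_)) (subsets _)
    ≡⟨ countᵇ-subsets-suc q ⟨
  countᵇ q (subsets _) ∎
  where open ≡-Reasoning

w-translate : {K K′ : SubGraph m} {P Q P′ Q′ : Subset m} (Γ : Subset m) →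
              (∀ S → Counted K P Q S ⇔ Counted K′ P′ Q′ (S ⊕ Γ)) → w K P Q ≡ w K′ P′ Q′
w-translate {K = K} {K′} {P} {Q} {P′} {Q′} Γ translate = begin
  w K P Q                      ≡⟨ countᵇ-cong counted-translate (subsets _) ⟩
  countᵇ (counted′ ∘ (_⊕ Γ)) (subsets _) ≡⟨ countᵇ-⊕ Γ counted′ ⟩
  w K′ P′ Q′                   ∎
  where
  open ≡-Reasoning
  counted′ : Subset _ → Bool
  counted′ S = isMaxStable K′ S ∧ (P′ ⊆ᵇ S) ∧ disjointᵇ S Q′
  counted-translate : ∀ S → T (isMaxStable K S ∧ (P ⊆ᵇ S) ∧ disjointᵇ S Q) ⇔ T (counted′ (S ⊕ Γ))
  counted-translate S = mk⇔
    (from counted⇔Counted ∘ to (translate S) ∘ to counted⇔Counted)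
    (from counted⇔Counted ∘ from (translate S) ∘ to counted⇔Counted)

-- Deleting a stable set whose neighbours carry leaves

record LeafOutside {m : ℕ} (C : SubGraph m) (Γ : Subset m) (v : Fin m) : Set where
  field
    leaf         : Fin m
    leaf∉Γ       : leaf ∉ Γ
    edge-to-leaf : T (edge C v leaf)
    leaf-pendant : ∀ {x} → T (edge C leaf x) → x ≡ v

module Deletion {m : ℕ} {G : Graph m} {C : SubGraph m} (C⊆G : IsSubgraphOf C G)
  {Γ : Subset m} (Γ-stable : Stable C Γ)
  (leafOutside : ∀ {γ v} → γ ∈ Γ → T (edge C γ v) → LeafOutside C Γ v) where

  open Subgraph {G = G} {C = C} C⊆G

  maximalStable-∪⇔ : Disjoint S Γ →
    (MaximalStable (C ∖ Γ) S × Disjoint S (N C Γ)) ⇔ MaximalStable C (S ∪ Γ)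
  maximalStable-∪⇔ {S = S} S#Γ = mk⇔ add-Γ remove-Γ
    where
    add-Γ : MaximalStable (C ∖ Γ) S × Disjoint S (N C Γ) → MaximalStable C (S ∪ Γ)
    add-Γ ((stS , maxS) , S#NΓ) = stT , maxT
      where
      stT : Stable C (S ∪ Γ)
      stT = stable-∪ (proj₁ (to (stable-∖⇔ C Γ) stS)) Γ-stable
        λ x∈S γ∈Γ e → S#NΓ x∈S (from (∈N⇔ C Γ) (_ , γ∈Γ , edge-sym e))
      maxT : v ∈ vert C → v ∉ S ∪ Γ → ¬ Stable C ((S ∪ Γ) ∪ ⁅ v ⁆)
      maxT {v = v} v∈C v∉T st =
        maxS (x∈p∧x∉q⇒x∈p─q v∈C v∉Γ) v∉S (from (stable-∖⇔ C Γ) (stable-⊆ sub st , S+v#Γ))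
        where
        v∉S : v ∉ S
        v∉S = v∉T ∘ x∈p∪q⁺ ∘ inj₁
        v∉Γ : v ∉ Γ
        v∉Γ = v∉T ∘ x∈p∪q⁺ ∘ inj₂
        sub : S ∪ ⁅ v ⁆ ⊆ (S ∪ Γ) ∪ ⁅ v ⁆
        sub = x∈p∪q⁺ ∘ Sum.map₁ (p⊆p∪q Γ) ∘ x∈p∪q⁻ S ⁅ v ⁆
        S+v#Γ : Disjoint (S ∪ ⁅ v ⁆) Γ
        S+v#Γ {x} x∈S+v =
          [ S#Γ , (λ x∈⁅v⁆ → subst (_∉ Γ) (≡-sym (x∈⁅y⁆⇒x≡y v x∈⁅v⁆)) v∉Γ) ] (x∈p∪q⁻ S ⁅ v ⁆ x∈S+v)

    remove-Γ : MaximalStable C (S ∪ Γ) → MaximalStable (C ∖ Γ) S × Disjoint S (N C Γ)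
    remove-Γ mT@(stT , maxT) = (stS , maxS) , S#NΓ
      where
      stS : Stable (C ∖ Γ) S
      stS = from (stable-∖⇔ C Γ) (stable-⊆ (p⊆p∪q Γ) stT , S#Γ)
      S#NΓ : Disjoint S (N C Γ)
      S#NΓ x∈S x∈NΓ = let _ , γ∈Γ , e = to (∈N⇔ C Γ) x∈NΓ in
        proj₂ stT (q⊆p∪q S Γ γ∈Γ) (p⊆p∪q Γ x∈S) e
      maxS : v ∈ vert (C ∖ Γ) → v ∉ S → ¬ Stable (C ∖ Γ) (S ∪ ⁅ v ⁆)
      maxS {v = v} v∈C∖Γ v∉S st = maxT v∈C v∉T (stable-∪ stT (stable-⁅⁆ v∈C) cross)
        where
        v∈C : v ∈ vert C
        v∈C = p─q⊆p (vert C) Γ v∈C∖Γ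
        v∉T : v ∉ S ∪ Γ
        v∉T = [ v∉S , x∈p─q⇒x∉q v∈C∖Γ ] ∘ x∈p∪q⁻ S Γ
        stC : Stable C (S ∪ ⁅ v ⁆)
        stC = proj₁ (to (stable-∖⇔ C Γ) st)
        v∈S+v : v ∈ S ∪ ⁅ v ⁆
        v∈S+v = x∈p∪q⁺ (inj₂ (x∈⁅x⁆ v))
        -- An edge from γ ∈ Γ to v is excluded through the leaf of v, which maximality of
        -- S ∪ Γ puts into S, next to v.
        noEdge : x ∈ S ⊎ x ∈ Γ → ¬ T (edge C x v)
        noEdge (inj₁ x∈S) = proj₂ stC (x∈p∪q⁺ (inj₁ x∈S)) v∈S+v
        noEdge (inj₂ γ∈Γ) e = proj₂ stC v∈S+v (x∈p∪q⁺ (inj₁ leaf∈S)) edge-to-leaf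
          where
          open LeafOutside (leafOutside γ∈Γ e)
          leaf∈T : leaf ∈ S ∪ Γ
          leaf∈T = ∈-maximalStable mT (edge⇒∈vert edge-to-leaf)
            λ e′ → subst (_∉ S ∪ Γ) (≡-sym (leaf-pendant e′)) v∉T
          leaf∈S : leaf ∈ S
          leaf∈S = x∈p∪q∧x∉q⇒x∈p leaf∈T leaf∉Γ
        cross : x ∈ S ∪ Γ → u ∈ ⁅ v ⁆ → ¬ T (edge C x u)
        cross {x = x} x∈T u∈⁅v⁆ =
          subst (λ u → ¬ T (edge C x u)) (≡-sym (x∈⁅y⁆⇒x≡y v u∈⁅v⁆)) (noEdge (x∈p∪q⁻ S Γ x∈T))

  counted-∪⇔ : Disjoint X Γ → Disjoint S Γ →
    Counted (C ∖ Γ) X (Z ∪ N C Γ) S ⇔ Counted C (X ∪ Γ) (Z ─ Γ) (S ∪ Γ)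
  counted-∪⇔ {X = X} {S = S} {Z = Z} X#Γ S#Γ = mk⇔ add-Γ remove-Γ
    where
    add-Γ : Counted (C ∖ Γ) X (Z ∪ N C Γ) S → Counted C (X ∪ Γ) (Z ─ Γ) (S ∪ Γ)
    add-Γ (mS , X⊆S , S#Z∪NΓ) =
      to (maximalStable-∪⇔ S#Γ) (mS , λ x∈S → S#Z∪NΓ x∈S ∘ x∈p∪q⁺ ∘ inj₂) ,
      x∈p∪q⁺ ∘ Sum.map₁ X⊆S ∘ x∈p∪q⁻ X Γ ,
      λ x∈S∪Γ x∈Z─Γ → [ (λ x∈S → S#Z∪NΓ x∈S (x∈p∪q⁺ (inj₁ (p─q⊆p Z Γ x∈Z─Γ)))) , x∈p─q⇒x∉q x∈Z─Γ ]
                        (x∈p∪q⁻ S Γ x∈S∪Γ)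
    remove-Γ : Counted C (X ∪ Γ) (Z ─ Γ) (S ∪ Γ) → Counted (C ∖ Γ) X (Z ∪ N C Γ) S
    remove-Γ (mT , X∪Γ⊆T , T#Z─Γ) =
      mS ,
      (λ x∈X → x∈p∪q∧x∉q⇒x∈p (X∪Γ⊆T (x∈p∪q⁺ (inj₁ x∈X))) (X#Γ x∈X)) ,
      λ x∈S x∈Z∪NΓ → [ (λ x∈Z → T#Z─Γ (x∈p∪q⁺ (inj₁ x∈S)) (x∈p∧x∉q⇒x∈p─q x∈Z (S#Γ x∈S))) , S#NΓ x∈S ]
                        (x∈p∪q⁻ Z (N C Γ) x∈Z∪NΓ)
      where
      mS : MaximalStable (C ∖ Γ) S
      mS = proj₁ (from (maximalStable-∪⇔ S#Γ) mT)
      S#NΓ : Disjoint S (N C Γ)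
      S#NΓ = proj₂ (from (maximalStable-∪⇔ S#Γ) mT)

  w-∖≡w-∪ : (X Z : Subset m) → Disjoint X Γ → w (C ∖ Γ) X (Z ∪ N C Γ) ≡ w C (X ∪ Γ) (Z ─ Γ)
  w-∖≡w-∪ X Z X#Γ = w-translate Γ translate
    where
    translate : ∀ S → Counted (C ∖ Γ) X (Z ∪ N C Γ) S ⇔ Counted C (X ∪ Γ) (Z ─ Γ) (S ⊕ Γ)
    translate S = mk⇔ add-Γ remove-Γ
      where
      add-Γ : Counted (C ∖ Γ) X (Z ∪ N C Γ) S → Counted C (X ∪ Γ) (Z ─ Γ) (S ⊕ Γ)
      add-Γ c = subst (Counted C (X ∪ Γ) (Z ─ Γ)) (≡-sym (⊕≡∪ S Γ S#Γ)) (to (counted-∪⇔ X#Γ S#Γ) c)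
        where
        S#Γ : Disjoint S Γ
        S#Γ = x∈p─q⇒x∉q ∘ proj₁ (proj₁ (proj₁ c))
      remove-Γ : Counted C (X ∪ Γ) (Z ─ Γ) (S ⊕ Γ) → Counted (C ∖ Γ) X (Z ∪ N C Γ) S
      remove-Γ c = from (counted-∪⇔ X#Γ S#Γ) (subst (Counted C (X ∪ Γ) (Z ─ Γ)) (⊕≡∪ S Γ S#Γ) c)
        where
        S#Γ : Disjoint S Γ
        S#Γ x∈S x∈Γ = x∈p∩q⇒x∉p⊕q x∈S x∈Γ (proj₁ (proj₂ c) (x∈p∪q⁺ (inj₂ x∈Γ)))

pendant-unique : (G : Graph m) {p : Fin m} → Pendant G p → T (adj G p u) → T (adj G p v) → u ≡ v
pendant-unique G {p} p-pendant =
  countᵇ≡1⇒≡ (adj G p) p-pendant (∈-allFin _) (∈-allFin _)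

module Decomposition {m : ℕ} {G : Graph m} {C H : SubGraph m} (D : IsDecomposition G C H)
  (I-independent : ∀ {u v} → u ∈ vert C ∩ vert H → v ∈ vert C ∩ vert H → ¬ T (adj G u v))
  {Γ : Subset m} (Γ⊆I : Γ ⊆ vert C ∩ vert H) where

  private
    module C = Subgraph {G = G} (proj₁ D)
    module H = Subgraph {G = G} (proj₁ (proj₂ D))

    edge-disjoint : ∀ u v → T (edge C u v) → T (edge H u v) → ⊥
    edge-disjoint = proj₁ (proj₂ (proj₂ D))

    adj≡edgeC∨edgeH : ∀ u v → adj G u v ≡ (edge C u v ∨ edge H u v)
    adj≡edgeC∨edgeH = proj₂ (proj₂ (proj₂ (proj₂ D)))

  Γ-stable : Stable C Γ
  Γ-stable = proj₁ ∘ x∈p∩q⁻ (vert C) (vert H) ∘ Γ⊆I ,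
             λ u∈Γ v∈Γ → I-independent (Γ⊆I u∈Γ) (Γ⊆I v∈Γ) ∘ C.edge⇒adj

  -- The leaf is the pendant neighbour of v given by 2-layeredness of γ. Its edge to v lies
  -- in C, as otherwise v ∈ V(C) ∩ V(H) would be adjacent to γ; and it is not in Γ, as its
  -- H-neighbour would then be v, making vp an edge of both C and H.
  leafOutside : (∀ v → v ∈ vert C ∩ vert H → TwoLayered G v) →
                (∀ v → v ∈ vert C ∩ vert H → ∃ λ u → T (edge H v u)) →
                ∀ {γ v} → γ ∈ Γ → T (edge C γ v) → LeafOutside C Γ v
  leafOutside twoLayered hasH {γ} {v} γ∈Γ γv
    with twoLayered γ (Γ⊆I γ∈Γ) v (C.edge⇒adj γv)
  ... | p , vp , p-pendant with to T-∨ (subst T (adj≡edgeC∨edgeH v p) vp)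
  ... | inj₂ vp∈H = contradiction (C.edge⇒adj γv)
        (I-independent (Γ⊆I γ∈Γ) (x∈p∩q⁺ (C.edge⇒∈vert γv , H.edge⇒∈vert (H.edge-sym vp∈H))))
  ... | inj₁ vp∈C = record
    { leaf = p ; leaf∉Γ = p∉Γ ; edge-to-leaf = vp∈C
    ; leaf-pendant = λ px → pendant-unique G p-pendant (C.edge⇒adj px) pv }
    where
    pv : T (adj G p v)
    pv = subst T (Graph.sym G v p) vp
    p∉Γ : p ∉ Γ
    p∉Γ p∈Γ with hasH p (Γ⊆I p∈Γ)
    ... | _ , py∈H = edge-disjoint p v (C.edge-sym vp∈C)
          (subst (T ∘ edge H p) (pendant-unique G p-pendant (H.edge⇒adj py∈H) pv) py∈H)

lemma3p3 : {m : ℕ} (G : Graph m) (C H : SubGraph m) →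
    IsDecomposition G C H →
    (∃ λ col → IsBipartition G col × (∀ u v → u ∈ vert C ∩ vert H → v ∈ vert C ∩ vert H → col u ≡ col v)) →
    (∀ v → v ∈ vert C ∩ vert H → TwoLayered G v) →
    (∀ v → v ∈ vert C ∩ vert H → ∃ λ u → T (edge C v u)) →
    (∀ v → v ∈ vert C ∩ vert H → ∃ λ u → T (edge H v u)) →
    (Θ Γ : Subset m) (b : Fin m) →
    Θ ⊆ vert C ∩ vert H →
    Γ ⊆ (vert C ∩ vert H) ─ Θ →
    b ∈ vert (C ∖ Γ) →
    (w (C ∖ Γ) Θ (((vert C ∩ vert H) ─ Θ) ∪ N C Γ) ≡ w C (Θ ∪ Γ) (((vert C ∩ vert H) ─ Θ) ─ Γ))
    × (w (C ∖ Γ) (⁅ b ⁆ ∪ Θ) (((vert C ∩ vert H) ─ Θ) ∪ N C Γ) ≡ w C ((⁅ b ⁆ ∪ Θ) ∪ Γ) (((vert C ∩ vert H) ─ Θ) ─ Γ))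
lemma3p3 G C H D (_ , bipartite , sameColour) twoLayered _ hasH Θ Γ b _ Γ⊆I─Θ b∈C∖Γ =
  w-∖≡w-∪ Θ Θᶜ Θ#Γ , w-∖≡w-∪ (⁅ b ⁆ ∪ Θ) Θᶜ b∪Θ#Γ
  where
  I-independent : ∀ {u v} → u ∈ vert C ∩ vert H → v ∈ vert C ∩ vert H → ¬ T (adj G u v)
  I-independent {u} {v} u∈I v∈I uv = bipartite u v uv (sameColour u v u∈I v∈I)

  open Decomposition {G = G} {C = C} {H = H} D I-independent {Γ = Γ} (p─q⊆p _ Θ ∘ Γ⊆I─Θ)
  open Deletion {G = G} {C = C} (proj₁ D) {Γ = Γ} Γ-stable (leafOutside twoLayered hasH)

  Θᶜ : Subset _
  Θᶜ = (vert C ∩ vert H) ─ Θ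

  Θ#Γ : Disjoint Θ Γ
  Θ#Γ θ∈Θ θ∈Γ = x∈p─q⇒x∉q (Γ⊆I─Θ θ∈Γ) θ∈Θ

  b∪Θ#Γ : Disjoint (⁅ b ⁆ ∪ Θ) Γ
  b∪Θ#Γ x∈b∪Θ = [ (λ x∈⁅b⁆ → subst (_∉ Γ) (≡-sym (x∈⁅y⁆⇒x≡y b x∈⁅b⁆)) (x∈p─q⇒x∉q b∈C∖Γ)) , Θ#Γ ]
                  (x∈p∪q⁻ ⁅ b ⁆ Θ x∈b∪Θ)
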